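{- Let $A=(\alpha_1,\dots,\alpha_q)$ with $q\ge1$, $\alpha_1\ge1$ and $\alpha_2,\dots,\alpha_q\ge2$ integers. Then there exists a polynomial $d(A;t)\in\mathbb{Z}[t]$ such that $D(A;t)=t^q d(A;t)$ and $d(A;0)\ne0$. Moreover, a greatest common divisor in $\mathbb{Z}[t]$ of $D(\alpha_1,\dots,\alpha_q;t)$ and $D(\alpha_2,\dots,\alpha_q;t)$ is $t^{q-1}$.
   Context: For $\alpha\in\mathbb{N}$ let $\phi_\alpha(t)=t+t^2+\dots+t^\alpha$. The polynomials $D(\alpha_1,\dots,\alpha_r;t)$ are defined by $D(\emptyset;t)=1$, $D(\alpha_1;t)=\phi_{\alpha_1}(t)$ and, for $r\ge2$, $D(\alpha_1,\dots,\alpha_r;t)=\phi_{\alpha_r}(t)D(\alpha_1,\dots,\alpha_{r-1};t)-t^{\alpha_r+1}D(\alpha_1,\dots,\alpha_{r-2};t)$ (equivalently, $D$ is the determinant of the tridiagonal matrix with diagonal $\phi_{\alpha_1}(t),\dots,\phi_{\alpha_r}(t)$, superdiagonal $t^{\alpha_2+1},\dots,t^{\alpha_r+1}$ and subdiagonal entries $1$). -}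

module Defs where

open import Data.Nat using (ℕ; zero; suc)
open import Data.Integer using (ℤ; 0ℤ; 1ℤ) renaming (_+_ to _+ℤ_; _*_ to _*ℤ_; -_ to -ℤ_)
open import Data.List using (List; []; _∷_; map; replicate; _++_; reverse)
open import Data.Product using (Σ; _×_)
open import Relation.Binary.PropositionalEquality using (_≡_)

-- Polynomials in ℤ[t] as coefficient lists, lowest degree first.
-- Trailing zeros are allowed; equality of polynomials is coefficientwise.
Poly : Set
Poly = List ℤ

coeff : Poly → ℕ → ℤ
coeff []      _       = 0ℤ
coeff (a ∷ p) zero    = a
coeff (a ∷ p) (suc n) = coeff p n

infix 4 _≈ₚ_
_≈ₚ_ : Poly → Poly → Set
p ≈ₚ q = ∀ n → coeff p n ≡ coeff q n

infixl 6 _+ₚ_ _-ₚ_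
infixl 7 _*ₚ_

_+ₚ_ : Poly → Poly → Poly
[]      +ₚ q       = q
(a ∷ p) +ₚ []      = a ∷ p
(a ∷ p) +ₚ (b ∷ q) = (a +ℤ b) ∷ (p +ₚ q)

negₚ : Poly → Poly
negₚ = map -ℤ_

_-ₚ_ : Poly → Poly → Poly
p -ₚ q = p +ₚ negₚ q

_*ₚ_ : Poly → Poly → Poly
[]      *ₚ q = []
(a ∷ p) *ₚ q = map (a *ℤ_) q +ₚ (0ℤ ∷ (p *ₚ q))

oneₚ : Poly
oneₚ = 1ℤ ∷ []

tpow : ℕ → Poly
tpow n = replicate n 0ℤ ++ (1ℤ ∷ [])

φ : ℕ → Poly
φ zero    = []
φ (suc n) = φ n +ₚ tpow (suc n)

-- Recursion on the reversed list (last entry first):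
-- Drev (α_r ∷ α_{r-1} ∷ ...) = φ_{α_r} · Drev(α_{r-1} ∷ ...) - t^{α_r+1} · Drev(α_{r-2} ∷ ...)
Drev : List ℕ → Poly
Drev []            = oneₚ
Drev (a ∷ [])      = φ a
Drev (a ∷ b ∷ rest) = φ a *ₚ Drev (b ∷ rest) -ₚ tpow (suc a) *ₚ Drev rest

D : List ℕ → Poly
D as = Drev (reverse as)

_∣ₚ_ : Poly → Poly → Set
p ∣ₚ q = Σ Poly (λ r → q ≈ₚ p *ₚ r)

IsGCDₚ : Poly → Poly → Poly → Set
IsGCDₚ p q g = (g ∣ₚ p) × (g ∣ₚ q) × (∀ h → h ∣ₚ p → h ∣ₚ q → h ∣ₚ g)

module Submission where

open import Defs
open import Level using (0ℓ)
open import Function using (_∘_)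
open import Data.Nat as ℕ using (ℕ; zero; suc; _≤_; s≤s; z≤n)
import Data.Nat.Properties as ℕ
open import Data.Nat.ListAction using (sum)
open import Data.Integer using (ℤ; 0ℤ; 1ℤ; _+_; _*_; -_)
import Data.Integer.Properties as ℤ
open import Data.Integer.Tactic.RingSolver using (solve-∀)
open import Data.List using (List; []; _∷_; map; _∷ʳ_; length; reverse)
open import Data.List.Properties using (unfold-reverse; length-reverse)
open import Data.List.Relation.Unary.All as All using (All; []; _∷_)
import Data.List.Relation.Unary.Any.Properties as Any
open import Data.Product using (Σ; _×_; _,_)
open import Data.Maybe using (Maybe; just; nothing)
open import Relation.Nullary using (yes)
open import Relation.Binary.PropositionalEquality
  using (_≡_; _≢_; refl; sym; trans; cong; cong₂; subst; module ≡-Reasoning)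
import Relation.Binary.Reasoning.Setoid as SetoidReasoning
open import Algebra.Bundles using (CommutativeRing)
import Algebra.Properties.Ring as RingProperties
import Tactic.RingSolver as RingSolver
open import Tactic.RingSolver.Core.AlmostCommutativeRing using (AlmostCommutativeRing; fromCommutativeRing)

-- Write φ_α = t·ψ_α with ψ_α = 1 + t + ⋯ + t^(α-1). Expanding D along its last entry,
-- D(α₁,…,α_r) = φ_{α_r}·D(α₁,…,α_{r-1}) − t^(α_r+1)·D(α₁,…,α_{r-2}), and for α_r ≥ 2 the
-- subtracted term is divisible by t^(r+1); so by induction D(α₁,…,α_r) = t^r·d with d(0) = 1.
-- For the gcd, the same recursion gives the Casoratian identity
--   D(α₁,…,α_q)·D(α₂,…,α_{q-1}) − D(α₁,…,α_{q-1})·D(α₂,…,α_q) = −t^N,  N = Σ_{i≥2} (α_i + 1),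
-- so a common divisor h of D(α₁,…,α_q) and D(α₂,…,α_q) divides t^N. Writing
-- D(α₂,…,α_q) = t^(q-1)·(1 + t·e), the identities t^(q-1+j) = D(α₂,…,α_q)·t^j − t^(q+j)·e
-- let h descend from t^(q-1+N) to t^(q-1).

conv : (ℕ → ℤ) → (ℕ → ℤ) → ℕ → ℤ
conv f g zero    = f 0 * g 0
conv f g (suc n) = f 0 * g (suc n) + conv (f ∘ suc) g n

conv-cong : ∀ {f f′ g g′} → (∀ m → f m ≡ f′ m) → (∀ m → g m ≡ g′ m) →
            ∀ n → conv f g n ≡ conv f′ g′ n
conv-cong f≗ g≗ zero    = cong₂ _*_ (f≗ 0) (g≗ 0)
conv-cong f≗ g≗ (suc n) = cong₂ _+_ (cong₂ _*_ (f≗ 0) (g≗ (suc n))) (conv-cong (f≗ ∘ suc) g≗ n)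

conv-zeroˡ : ∀ g n → conv (λ _ → 0ℤ) g n ≡ 0ℤ
conv-zeroˡ g zero    = refl
conv-zeroˡ g (suc n) = trans (ℤ.+-identityˡ _) (conv-zeroˡ g n)

conv-distribʳ-+ : ∀ f f′ g n → conv (λ m → f m + f′ m) g n ≡ conv f g n + conv f′ g n
conv-distribʳ-+ f f′ g zero    = ℤ.*-distribʳ-+ (g 0) (f 0) (f′ 0)
conv-distribʳ-+ f f′ g (suc n)
  rewrite conv-distribʳ-+ (f ∘ suc) (f′ ∘ suc) g n =
  rearrange (f 0) (f′ 0) (g (suc n)) (conv (f ∘ suc) g n) (conv (f′ ∘ suc) g n)
  where
  rearrange : ∀ a b c x y → (a + b) * c + (x + y) ≡ (a * c + x) + (b * c + y)
  rearrange = solve-∀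

conv-scaleˡ : ∀ a f g n → conv (λ m → a * f m) g n ≡ a * conv f g n
conv-scaleˡ a f g zero    = ℤ.*-assoc a (f 0) (g 0)
conv-scaleˡ a f g (suc n)
  rewrite conv-scaleˡ a (f ∘ suc) g n =
  trans (cong (_+ a * conv (f ∘ suc) g n) (ℤ.*-assoc a (f 0) (g (suc n))))
        (sym (ℤ.*-distribˡ-+ a (f 0 * g (suc n)) (conv (f ∘ suc) g n)))

conv-unfoldʳ : ∀ f g n → conv f g (suc n) ≡ conv f (g ∘ suc) n + f (suc n) * g 0
conv-unfoldʳ f g zero    = refl
conv-unfoldʳ f g (suc n)
  rewrite conv-unfoldʳ (f ∘ suc) g n =
  sym (ℤ.+-assoc (f 0 * g (suc (suc n))) (conv (f ∘ suc) (g ∘ suc) n) (f (suc (suc n)) * g 0))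

conv-comm : ∀ f g n → conv f g n ≡ conv g f n
conv-comm f g zero    = ℤ.*-comm (f 0) (g 0)
conv-comm f g (suc n) = begin
  f 0 * g (suc n) + conv (f ∘ suc) g n  ≡⟨ cong (f 0 * g (suc n) +_) (conv-comm (f ∘ suc) g n) ⟩
  f 0 * g (suc n) + conv g (f ∘ suc) n  ≡⟨ rearrange (f 0) (g (suc n)) (conv g (f ∘ suc) n) ⟩
  conv g (f ∘ suc) n + g (suc n) * f 0  ≡⟨ conv-unfoldʳ g f n ⟨
  conv g f (suc n)                      ∎
  where
  open ≡-Reasoning
  rearrange : ∀ a b x → a * b + x ≡ x + b * a
  rearrange = solve-∀

conv-assoc : ∀ f g h n → conv (conv f g) h n ≡ conv f (conv g h) n
conv-assoc f g h zero    = ℤ.*-assoc (f 0) (g 0) (h 0)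
conv-assoc f g h (suc n) = begin
  conv f g 0 * h (suc n) + conv (λ m → f 0 * g (suc m) + conv (f ∘ suc) g m) h n
    ≡⟨ cong (conv f g 0 * h (suc n) +_) (conv-distribʳ-+ (λ m → f 0 * g (suc m)) (conv (f ∘ suc) g) h n) ⟩
  conv f g 0 * h (suc n) + (conv (λ m → f 0 * g (suc m)) h n + conv (conv (f ∘ suc) g) h n)
    ≡⟨ cong₂ (λ u v → conv f g 0 * h (suc n) + (u + v))
             (conv-scaleˡ (f 0) (g ∘ suc) h n) (conv-assoc (f ∘ suc) g h n) ⟩
  f 0 * g 0 * h (suc n) + (f 0 * conv (g ∘ suc) h n + conv (f ∘ suc) (conv g h) n)
    ≡⟨ rearrange (f 0) (g 0) (h (suc n)) (conv (g ∘ suc) h n) (conv (f ∘ suc) (conv g h) n) ⟩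
  f 0 * (g 0 * h (suc n) + conv (g ∘ suc) h n) + conv (f ∘ suc) (conv g h) n
    ∎
  where
  open ≡-Reasoning
  rearrange : ∀ a b c x y → a * b * c + (a * x + y) ≡ a * (b * c + x) + y
  rearrange = solve-∀

coeff-+ₚ : ∀ p q n → coeff (p +ₚ q) n ≡ coeff p n + coeff q n
coeff-+ₚ []      q       n       = sym (ℤ.+-identityˡ _)
coeff-+ₚ (a ∷ p) []      n       = sym (ℤ.+-identityʳ _)
coeff-+ₚ (a ∷ p) (b ∷ q) zero    = refl
coeff-+ₚ (a ∷ p) (b ∷ q) (suc n) = coeff-+ₚ p q n

coeff-negₚ : ∀ p n → coeff (negₚ p) n ≡ - coeff p n
coeff-negₚ []      n       = refl
coeff-negₚ (a ∷ p) zero    = refl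
coeff-negₚ (a ∷ p) (suc n) = coeff-negₚ p n

coeff-scale : ∀ a p n → coeff (map (a *_) p) n ≡ a * coeff p n
coeff-scale a []      n       = sym (ℤ.*-zeroʳ a)
coeff-scale a (b ∷ p) zero    = refl
coeff-scale a (b ∷ p) (suc n) = coeff-scale a p n

coeff-*ₚ : ∀ p q n → coeff (p *ₚ q) n ≡ conv (coeff p) (coeff q) n
coeff-*ₚ []      q n       = sym (conv-zeroˡ (coeff q) n)
coeff-*ₚ (a ∷ p) q zero    =
  trans (coeff-+ₚ (map (a *_) q) (0ℤ ∷ (p *ₚ q)) 0)
        (trans (ℤ.+-identityʳ _) (coeff-scale a q 0))
coeff-*ₚ (a ∷ p) q (suc n) =
  trans (coeff-+ₚ (map (a *_) q) (0ℤ ∷ (p *ₚ q)) (suc n))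
        (cong₂ _+_ (coeff-scale a q (suc n)) (coeff-*ₚ p q n))

conv-identityˡ : ∀ g n → conv (coeff oneₚ) g n ≡ g n
conv-identityˡ g zero    = ℤ.*-identityˡ (g 0)
conv-identityˡ g (suc n) =
  trans (cong (1ℤ * g (suc n) +_) (conv-zeroˡ g n))
        (trans (ℤ.+-identityʳ _) (ℤ.*-identityˡ (g (suc n))))

-- Coefficientwise equality wrapped in a record: the ring solver normalises its goal and would
-- unfold the Π-type ≈ₚ, and Agda cannot infer polynomials through it. The same holds for _∣_ below.
infix 4 _≋_
record _≋_ (p q : Poly) : Set where
  constructor mk≋
  field get : p ≈ₚ q
open _≋_ public

≋-refl : ∀ {p} → p ≋ p
≋-refl = mk≋ λ _ → refl

≋-sym : ∀ {p q} → p ≋ q → q ≋ p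
≋-sym (mk≋ e) = mk≋ λ n → sym (e n)

≋-trans : ∀ {p q r} → p ≋ q → q ≋ r → p ≋ r
≋-trans (mk≋ e) (mk≋ e′) = mk≋ λ n → trans (e n) (e′ n)

+ₚ-cong : ∀ {p p′ q q′} → p ≋ p′ → q ≋ q′ → p +ₚ q ≋ p′ +ₚ q′
+ₚ-cong {p} {p′} {q} {q′} (mk≋ e) (mk≋ e′) = mk≋ λ n →
  trans (coeff-+ₚ p q n) (trans (cong₂ _+_ (e n) (e′ n)) (sym (coeff-+ₚ p′ q′ n)))

*ₚ-cong : ∀ {p p′ q q′} → p ≋ p′ → q ≋ q′ → p *ₚ q ≋ p′ *ₚ q′
*ₚ-cong {p} {p′} {q} {q′} (mk≋ e) (mk≋ e′) = mk≋ λ n →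
  trans (coeff-*ₚ p q n) (trans (conv-cong e e′ n) (sym (coeff-*ₚ p′ q′ n)))

negₚ-cong : ∀ {p p′} → p ≋ p′ → negₚ p ≋ negₚ p′
negₚ-cong {p} {p′} (mk≋ e) = mk≋ λ n →
  trans (coeff-negₚ p n) (trans (cong -_ (e n)) (sym (coeff-negₚ p′ n)))

+ₚ-assoc : ∀ p q r → (p +ₚ q) +ₚ r ≋ p +ₚ (q +ₚ r)
+ₚ-assoc p q r = mk≋ λ n → begin
  coeff ((p +ₚ q) +ₚ r) n            ≡⟨ coeff-+ₚ (p +ₚ q) r n ⟩
  coeff (p +ₚ q) n + coeff r n       ≡⟨ cong (_+ coeff r n) (coeff-+ₚ p q n) ⟩
  coeff p n + coeff q n + coeff r n  ≡⟨ ℤ.+-assoc (coeff p n) _ _ ⟩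
  coeff p n + (coeff q n + coeff r n) ≡⟨ cong (coeff p n +_) (coeff-+ₚ q r n) ⟨
  coeff p n + coeff (q +ₚ r) n       ≡⟨ coeff-+ₚ p (q +ₚ r) n ⟨
  coeff (p +ₚ (q +ₚ r)) n            ∎
  where open ≡-Reasoning

+ₚ-comm : ∀ p q → p +ₚ q ≋ q +ₚ p
+ₚ-comm p q = mk≋ λ n →
  trans (coeff-+ₚ p q n) (trans (ℤ.+-comm (coeff p n) _) (sym (coeff-+ₚ q p n)))

+ₚ-identityʳ : ∀ p → p +ₚ [] ≋ p
+ₚ-identityʳ p = mk≋ λ n → trans (coeff-+ₚ p [] n) (ℤ.+-identityʳ _)

+ₚ-inverseˡ : ∀ p → negₚ p +ₚ p ≋ []
+ₚ-inverseˡ p = mk≋ λ n →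
  trans (coeff-+ₚ (negₚ p) p n)
        (trans (cong (_+ coeff p n) (coeff-negₚ p n)) (ℤ.+-inverseˡ (coeff p n)))

+ₚ-inverseʳ : ∀ p → p +ₚ negₚ p ≋ []
+ₚ-inverseʳ p = ≋-trans (+ₚ-comm p (negₚ p)) (+ₚ-inverseˡ p)

*ₚ-assoc : ∀ p q r → (p *ₚ q) *ₚ r ≋ p *ₚ (q *ₚ r)
*ₚ-assoc p q r = mk≋ λ n → begin
  coeff ((p *ₚ q) *ₚ r) n                      ≡⟨ coeff-*ₚ (p *ₚ q) r n ⟩
  conv (coeff (p *ₚ q)) (coeff r) n            ≡⟨ conv-cong (coeff-*ₚ p q) (λ _ → refl) n ⟩
  conv (conv (coeff p) (coeff q)) (coeff r) n  ≡⟨ conv-assoc (coeff p) (coeff q) (coeff r) n ⟩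
  conv (coeff p) (conv (coeff q) (coeff r)) n  ≡⟨ conv-cong (λ _ → refl) (coeff-*ₚ q r) n ⟨
  conv (coeff p) (coeff (q *ₚ r)) n            ≡⟨ coeff-*ₚ p (q *ₚ r) n ⟨
  coeff (p *ₚ (q *ₚ r)) n                      ∎
  where open ≡-Reasoning

*ₚ-comm : ∀ p q → p *ₚ q ≋ q *ₚ p
*ₚ-comm p q = mk≋ λ n →
  trans (coeff-*ₚ p q n) (trans (conv-comm (coeff p) (coeff q) n) (sym (coeff-*ₚ q p n)))

*ₚ-identityˡ : ∀ p → oneₚ *ₚ p ≋ p
*ₚ-identityˡ p = mk≋ λ n → trans (coeff-*ₚ oneₚ p n) (conv-identityˡ (coeff p) n)

*ₚ-identityʳ : ∀ p → p *ₚ oneₚ ≋ p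
*ₚ-identityʳ p = ≋-trans (*ₚ-comm p oneₚ) (*ₚ-identityˡ p)

*ₚ-distribʳ-+ₚ : ∀ r p q → (p +ₚ q) *ₚ r ≋ p *ₚ r +ₚ q *ₚ r
*ₚ-distribʳ-+ₚ r p q = mk≋ λ n → begin
  coeff ((p +ₚ q) *ₚ r) n                                 ≡⟨ coeff-*ₚ (p +ₚ q) r n ⟩
  conv (coeff (p +ₚ q)) (coeff r) n                       ≡⟨ conv-cong (coeff-+ₚ p q) (λ _ → refl) n ⟩
  conv (λ m → coeff p m + coeff q m) (coeff r) n          ≡⟨ conv-distribʳ-+ (coeff p) (coeff q) (coeff r) n ⟩
  conv (coeff p) (coeff r) n + conv (coeff q) (coeff r) n ≡⟨ cong₂ _+_ (coeff-*ₚ p r n) (coeff-*ₚ q r n) ⟨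
  coeff (p *ₚ r) n + coeff (q *ₚ r) n                     ≡⟨ coeff-+ₚ (p *ₚ r) (q *ₚ r) n ⟨
  coeff (p *ₚ r +ₚ q *ₚ r) n                              ∎
  where open ≡-Reasoning

*ₚ-distribˡ-+ₚ : ∀ r p q → r *ₚ (p +ₚ q) ≋ r *ₚ p +ₚ r *ₚ q
*ₚ-distribˡ-+ₚ r p q =
  ≋-trans (*ₚ-comm r (p +ₚ q)) (≋-trans (*ₚ-distribʳ-+ₚ r p q) (+ₚ-cong (*ₚ-comm p r) (*ₚ-comm q r)))

ℤ[t] : CommutativeRing 0ℓ 0ℓ
ℤ[t] = record
  { Carrier = Poly ; _≈_ = _≋_ ; _+_ = _+ₚ_ ; _*_ = _*ₚ_ ; -_ = negₚ ; 0# = [] ; 1# = oneₚ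
  ; isCommutativeRing = record
    { isRing = record
      { +-isAbelianGroup = record
        { isGroup = record
          { isMonoid = record
            { isSemigroup = record
              { isMagma = record
                { isEquivalence = record { refl = ≋-refl ; sym = ≋-sym ; trans = ≋-trans }
                ; ∙-cong = +ₚ-cong }
              ; assoc = +ₚ-assoc }
            ; identity = (λ _ → ≋-refl) , +ₚ-identityʳ }
          ; inverse = +ₚ-inverseˡ , +ₚ-inverseʳ
          ; ⁻¹-cong = negₚ-cong }
        ; comm = +ₚ-comm }
      ; *-cong = *ₚ-cong
      ; *-assoc = *ₚ-assoc
      ; *-identity = *ₚ-identityˡ , *ₚ-identityʳ
      ; distrib = *ₚ-distribˡ-+ₚ , *ₚ-distribʳ-+ₚ }
    ; *-comm = *ₚ-comm } }

ℤ[t]-almostCommutativeRing : AlmostCommutativeRing 0ℓ 0ℓ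
ℤ[t]-almostCommutativeRing = fromCommutativeRing ℤ[t] []≋?
  where
  -- Without a zero test the solver cannot cancel terms such as p − p.
  []≋? : ∀ p → Maybe ([] ≋ p)
  []≋? []      = just ≋-refl
  []≋? (a ∷ p) with a ℤ.≟ 0ℤ | []≋? p
  ... | yes a≡0 | just (mk≋ e) = just (mk≋ λ { zero → sym a≡0 ; (suc n) → e n })
  ... | _       | _            = nothing

module ≋-Reasoning = SetoidReasoning (CommutativeRing.setoid ℤ[t])
open RingProperties (CommutativeRing.ring ℤ[t]) using (-‿distribʳ-*; -‿involutive)

t : Poly
t = tpow 1

t*-cong : ∀ {p q} → p ≋ q → t *ₚ p ≋ t *ₚ q
t*-cong = *ₚ-cong (≋-refl {t})

0∷≋t*ₚ : ∀ p → 0ℤ ∷ p ≋ t *ₚ p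
0∷≋t*ₚ p = mk≋ λ n → sym (trans (coeff-*ₚ t p n) (conv-t n))
  where
  conv-t : ∀ n → conv (coeff t) (coeff p) n ≡ coeff (0ℤ ∷ p) n
  conv-t zero    = refl
  conv-t (suc n) = trans (ℤ.+-identityˡ _) (conv-identityˡ (coeff p) n)

coeff₀-t*ₚ : ∀ p → coeff (t *ₚ p) 0 ≡ 0ℤ
coeff₀-t*ₚ p = sym (get (0∷≋t*ₚ p) 0)

tpow-suc : ∀ n → tpow (suc n) ≋ t *ₚ tpow n
tpow-suc n = 0∷≋t*ₚ (tpow n)

tpow-+ : ∀ m n → tpow (m ℕ.+ n) ≋ tpow m *ₚ tpow n
tpow-+ zero    n = ≋-sym (*ₚ-identityˡ (tpow n))
tpow-+ (suc m) n = begin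
  tpow (suc m ℕ.+ n)         ≈⟨ tpow-suc (m ℕ.+ n) ⟩
  t *ₚ tpow (m ℕ.+ n)        ≈⟨ t*-cong (tpow-+ m n) ⟩
  t *ₚ (tpow m *ₚ tpow n)    ≈⟨ *ₚ-assoc t (tpow m) (tpow n) ⟨
  (t *ₚ tpow m) *ₚ tpow n    ≈⟨ *ₚ-cong (tpow-suc m) ≋-refl ⟨
  tpow (suc m) *ₚ tpow n     ∎
  where open ≋-Reasoning

ψ : ℕ → Poly
ψ zero    = []
ψ (suc n) = ψ n +ₚ tpow n

φ≋t*ψ : ∀ n → φ n ≋ t *ₚ ψ n
φ≋t*ψ zero    = ≋-sym (*ₚ-comm t [])
φ≋t*ψ (suc n) = ≋-trans (+ₚ-cong (φ≋t*ψ n) (tpow-suc n)) (≋-sym (*ₚ-distribˡ-+ₚ t (ψ n) (tpow n)))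

coeff₀-ψ : ∀ n → coeff (ψ (suc n)) 0 ≡ 1ℤ
coeff₀-ψ zero    = refl
coeff₀-ψ (suc n) = trans (coeff-+ₚ (ψ (suc n)) (tpow (suc n)) 0) (cong (_+ 0ℤ) (coeff₀-ψ n))

record LowestTerm (n : ℕ) (P : Poly) : Set where
  constructor lowestTerm
  field
    cofactor        : Poly
    factorisation   : P ≋ tpow n *ₚ cofactor
    coeff₀-cofactor : coeff cofactor 0 ≡ 1ℤ

infix 4 _∣_
record _∣_ (h p : Poly) : Set where
  constructor divides
  field
    quotient : Poly
    equation : p ≋ h *ₚ quotient

∣ₚ⇒∣ : ∀ {h p} → h ∣ₚ p → h ∣ p
∣ₚ⇒∣ {h} {p} (r , p≈hr) = divides r (mk≋ {p} {h *ₚ r} p≈hr)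

∣⇒∣ₚ : ∀ {h p} → h ∣ p → h ∣ₚ p
∣⇒∣ₚ (divides r p≋hr) = r , get p≋hr

∣-resp-≋ : ∀ {h p q} → p ≋ q → h ∣ p → h ∣ q
∣-resp-≋ p≋q (divides r p≋hr) = divides r (≋-trans (≋-sym p≋q) p≋hr)

∣-+ₚ : ∀ {h p q} → h ∣ p → h ∣ q → h ∣ p +ₚ q
∣-+ₚ {h} (divides r p≋hr) (divides s q≋hs) =
  divides (r +ₚ s) (≋-trans (+ₚ-cong p≋hr q≋hs) (≋-sym (*ₚ-distribˡ-+ₚ h r s)))

∣-*ₚʳ : ∀ {h p} u → h ∣ p → h ∣ p *ₚ u
∣-*ₚʳ {h} u (divides r p≋hr) = divides (r *ₚ u) (≋-trans (*ₚ-cong p≋hr ≋-refl) (*ₚ-assoc h r u))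

lowestTerm⇒tpow∣ : ∀ k {n P} → LowestTerm (k ℕ.+ n) P → tpow n ∣ P
lowestTerm⇒tpow∣ k {n} {P} (lowestTerm d P≋ _) = divides (tpow k *ₚ d) (begin
  P                          ≈⟨ P≋ ⟩
  tpow (k ℕ.+ n) *ₚ d        ≈⟨ *ₚ-cong (tpow-+ k n) ≋-refl ⟩
  (tpow k *ₚ tpow n) *ₚ d    ≈⟨ swap (tpow k) (tpow n) d ⟩
  tpow n *ₚ (tpow k *ₚ d)    ∎)
  where
  open ≋-Reasoning
  swap : ∀ a b c → (a *ₚ b) *ₚ c ≋ b *ₚ (a *ₚ c)
  swap = RingSolver.solve-∀ ℤ[t]-almostCommutativeRing

-- As x ≥ 2, t^(x+1)·P₀ is divisible by t^(n+3), so only φ_x·P₁ contributes the lowest term.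
lowestTerm-step : ∀ x {n P₁ P₀} → 2 ≤ x → LowestTerm (suc n) P₁ → tpow n ∣ P₀ →
                  LowestTerm (suc (suc n)) (φ x *ₚ P₁ -ₚ tpow (suc x) *ₚ P₀)
lowestTerm-step x@(suc (suc k)) {n} {P₁} {P₀} (s≤s (s≤s z≤n)) (lowestTerm d₁ P₁≋ coeff₀-d₁) (divides d₀ P₀≋) =
  lowestTerm d P≋ coeff₀-d
  where
  T = tpow n
  K = tpow k
  d = ψ x *ₚ d₁ -ₚ t *ₚ (K *ₚ d₀)

  t²T : tpow (suc (suc n)) ≋ t *ₚ (t *ₚ T)
  t²T = ≋-trans (tpow-suc (suc n)) (t*-cong (tpow-suc n))

  t³K : tpow (suc x) ≋ t *ₚ (t *ₚ (t *ₚ K))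
  t³K = ≋-trans (tpow-suc (suc (suc k))) (t*-cong (≋-trans (tpow-suc (suc k)) (t*-cong (tpow-suc k))))

  factor : ∀ t ψ T K d₁ d₀ → (t *ₚ ψ) *ₚ ((t *ₚ T) *ₚ d₁) -ₚ (t *ₚ (t *ₚ (t *ₚ K))) *ₚ (T *ₚ d₀)
                             ≋ (t *ₚ (t *ₚ T)) *ₚ (ψ *ₚ d₁ -ₚ t *ₚ (K *ₚ d₀))
  factor = RingSolver.solve-∀ ℤ[t]-almostCommutativeRing

  P≋ : φ x *ₚ P₁ -ₚ tpow (suc x) *ₚ P₀ ≋ tpow (suc (suc n)) *ₚ d
  P≋ = begin
    φ x *ₚ P₁ -ₚ tpow (suc x) *ₚ P₀
      ≈⟨ +ₚ-cong (*ₚ-cong (φ≋t*ψ x) (≋-trans P₁≋ (*ₚ-cong (tpow-suc n) ≋-refl)))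
                 (negₚ-cong (*ₚ-cong t³K P₀≋)) ⟩
    (t *ₚ ψ x) *ₚ ((t *ₚ T) *ₚ d₁) -ₚ (t *ₚ (t *ₚ (t *ₚ K))) *ₚ (T *ₚ d₀)
      ≈⟨ factor t (ψ x) T K d₁ d₀ ⟩
    (t *ₚ (t *ₚ T)) *ₚ d
      ≈⟨ *ₚ-cong t²T ≋-refl ⟨
    tpow (suc (suc n)) *ₚ d ∎
    where open ≋-Reasoning

  coeff₀-d : coeff d 0 ≡ 1ℤ
  coeff₀-d = begin
    coeff d 0
      ≡⟨ coeff-+ₚ (ψ x *ₚ d₁) (negₚ (t *ₚ (K *ₚ d₀))) 0 ⟩
    coeff (ψ x *ₚ d₁) 0 + coeff (negₚ (t *ₚ (K *ₚ d₀))) 0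
      ≡⟨ cong₂ _+_ (coeff-*ₚ (ψ x) d₁ 0) (coeff-negₚ (t *ₚ (K *ₚ d₀)) 0) ⟩
    coeff (ψ x) 0 * coeff d₁ 0 + - coeff (t *ₚ (K *ₚ d₀)) 0
      ≡⟨ cong₂ (λ a b → a * coeff d₁ 0 + - b) (coeff₀-ψ (suc k)) (coeff₀-t*ₚ (K *ₚ d₀)) ⟩
    1ℤ * coeff d₁ 0 + - 0ℤ
      ≡⟨ trans (ℤ.+-identityʳ _) (trans (ℤ.*-identityˡ _) coeff₀-d₁) ⟩
    1ℤ ∎
    where open ≡-Reasoning

-- Drev reads α_r,…,α₁, so the hypotheses of the theorem become: every entry is ≥ 2,
-- except the last one, which is ≥ 1.
data Admissible : List ℕ → Set where
  []  : Admissible []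
  [_] : ∀ {a} → 1 ≤ a → Admissible (a ∷ [])
  _∷_ : ∀ {x y r} → 2 ≤ x → Admissible (y ∷ r) → Admissible (x ∷ y ∷ r)

Drev-lowestTerm : ∀ {M} → Admissible M → LowestTerm (length M) (Drev M)
Drev-lowestTerm []                          = lowestTerm oneₚ (≋-sym (*ₚ-identityˡ oneₚ)) refl
Drev-lowestTerm [ s≤s {n = k} z≤n ]          = lowestTerm (ψ (suc k)) (φ≋t*ψ (suc k)) (coeff₀-ψ k)
Drev-lowestTerm {x ∷ _} (2≤x ∷ [ 1≤a ])     =
  lowestTerm-step x 2≤x (Drev-lowestTerm [ 1≤a ]) (lowestTerm⇒tpow∣ 0 (Drev-lowestTerm []))
Drev-lowestTerm {x ∷ _} (2≤x ∷ 2≤y ∷ adm) =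
  lowestTerm-step x 2≤x (Drev-lowestTerm (2≤y ∷ adm)) (lowestTerm⇒tpow∣ 0 (Drev-lowestTerm adm))

∣tpow⇒∣lowestTerm : ∀ {h m N P} → LowestTerm m P → h ∣ P → h ∣ tpow N → h ∣ tpow m
∣tpow⇒∣lowestTerm {h} {m} {N} {P} (lowestTerm (_ ∷ e) P≋ refl) h∣P h∣tᴺ =
  descend N (∣-resp-≋ (≋-trans (*ₚ-comm (tpow N) (tpow m)) (≋-sym (tpow-+ m N))) (∣-*ₚʳ (tpow m) h∣tᴺ))
  where
  T = tpow m

  peel : ∀ j → P *ₚ tpow j +ₚ tpow (m ℕ.+ suc j) *ₚ negₚ e ≋ tpow (m ℕ.+ j)
  peel j = begin
    P *ₚ J +ₚ tpow (m ℕ.+ suc j) *ₚ negₚ e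
      ≈⟨ +ₚ-cong (*ₚ-cong (≋-trans P≋ (*ₚ-cong (≋-refl {T}) (+ₚ-cong (≋-refl {oneₚ}) (0∷≋t*ₚ e)))) ≋-refl)
                 (*ₚ-cong (≋-trans (tpow-+ m (suc j)) (*ₚ-cong (≋-refl {T}) (tpow-suc j))) ≋-refl) ⟩
    (T *ₚ (oneₚ +ₚ t *ₚ e)) *ₚ J +ₚ (T *ₚ (t *ₚ J)) *ₚ negₚ e
      ≈⟨ cancel T t e J ⟩
    T *ₚ J
      ≈⟨ tpow-+ m j ⟨
    tpow (m ℕ.+ j) ∎
    where
    open ≋-Reasoning
    J = tpow j
    cancel : ∀ T t e J → (T *ₚ (oneₚ +ₚ t *ₚ e)) *ₚ J +ₚ (T *ₚ (t *ₚ J)) *ₚ negₚ e ≋ T *ₚ J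
    cancel = RingSolver.solve-∀ ℤ[t]-almostCommutativeRing

  descend : ∀ j → h ∣ tpow (m ℕ.+ j) → h ∣ tpow m
  descend zero    h∣ = subst (λ i → h ∣ tpow i) (ℕ.+-identityʳ m) h∣
  descend (suc j) h∣ = descend j (∣-resp-≋ (peel j) (∣-+ₚ (∣-*ₚʳ (tpow j) h∣P) (∣-*ₚʳ (negₚ e) h∣)))

Drev-casoratian : ∀ a x M → Drev (x ∷ M ∷ʳ a) *ₚ Drev M -ₚ Drev (M ∷ʳ a) *ₚ Drev (x ∷ M)
                            ≋ negₚ (tpow (sum (map suc (x ∷ M))))
Drev-casoratian a x [] = ≋-trans (base (φ x) (φ a) (tpow (suc x))) (negₚ-cong (≋-sym (tpow-+ (suc x) 0)))
  where
  base : ∀ p q T → (p *ₚ q -ₚ T *ₚ oneₚ) *ₚ oneₚ -ₚ q *ₚ p ≋ negₚ (T *ₚ oneₚ)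
  base = RingSolver.solve-∀ ℤ[t]-almostCommutativeRing
Drev-casoratian a x (y ∷ M) = begin
  (φ x *ₚ A₁ -ₚ T *ₚ A₀) *ₚ B₁ -ₚ A₁ *ₚ (φ x *ₚ B₁ -ₚ T *ₚ B₀)  ≈⟨ step (φ x) T A₁ A₀ B₁ B₀ ⟩
  T *ₚ (A₁ *ₚ B₀ -ₚ A₀ *ₚ B₁)                                   ≈⟨ *ₚ-cong (≋-refl {T}) (Drev-casoratian a y M) ⟩
  T *ₚ negₚ (tpow N)                                             ≈⟨ -‿distribʳ-* T (tpow N) ⟨
  negₚ (T *ₚ tpow N)                                             ≈⟨ negₚ-cong (tpow-+ (suc x) N) ⟨
  negₚ (tpow (suc x ℕ.+ N))                                      ∎
  where
  open ≋-Reasoning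
  T  = tpow (suc x)
  N  = sum (map suc (y ∷ M))
  A₁ = Drev (y ∷ M ∷ʳ a)
  A₀ = Drev (M ∷ʳ a)
  B₁ = Drev (y ∷ M)
  B₀ = Drev M
  step : ∀ f T A₁ A₀ B₁ B₀ → (f *ₚ A₁ -ₚ T *ₚ A₀) *ₚ B₁ -ₚ A₁ *ₚ (f *ₚ B₁ -ₚ T *ₚ B₀)
                           ≋ T *ₚ (A₁ *ₚ B₀ -ₚ A₀ *ₚ B₁)
  step = RingSolver.solve-∀ ℤ[t]-almostCommutativeRing

∣Drev∷ʳ∧∣Drev⇒∣tpow : ∀ a M {h} → h ∣ Drev (M ∷ʳ a) → h ∣ Drev M → h ∣ tpow (sum (map suc M))
∣Drev∷ʳ∧∣Drev⇒∣tpow a []      h∣X h∣1 = h∣1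
∣Drev∷ʳ∧∣Drev⇒∣tpow a (x ∷ M) h∣X h∣Y =
  ∣-resp-≋ bezout (∣-+ₚ (∣-*ₚʳ (Drev (M ∷ʳ a)) h∣Y) (∣-*ₚʳ (negₚ (Drev M)) h∣X))
  where
  open ≋-Reasoning
  X  = Drev (x ∷ M ∷ʳ a)
  Y  = Drev (x ∷ M)
  combine : ∀ X Y A B → Y *ₚ A +ₚ X *ₚ negₚ B ≋ negₚ (X *ₚ B -ₚ A *ₚ Y)
  combine = RingSolver.solve-∀ ℤ[t]-almostCommutativeRing
  bezout : Y *ₚ Drev (M ∷ʳ a) +ₚ X *ₚ negₚ (Drev M) ≋ tpow (sum (map suc (x ∷ M)))
  bezout = begin
    Y *ₚ Drev (M ∷ʳ a) +ₚ X *ₚ negₚ (Drev M)      ≈⟨ combine X Y (Drev (M ∷ʳ a)) (Drev M) ⟩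
    negₚ (X *ₚ Drev M -ₚ Drev (M ∷ʳ a) *ₚ Y)       ≈⟨ negₚ-cong (Drev-casoratian a x M) ⟩
    negₚ (negₚ (tpow (sum (map suc (x ∷ M)))))     ≈⟨ -‿involutive _ ⟩
    tpow (sum (map suc (x ∷ M)))                   ∎

All-reverse : ∀ {P : ℕ → Set} {xs} → All P xs → All P (reverse xs)
All-reverse Pxs = All.tabulate (All.lookup Pxs ∘ Any.reverse⁻)

admissible-snoc : ∀ {L a} → All (2 ≤_) L → 1 ≤ a → Admissible (L ∷ʳ a)
admissible-snoc []                    1≤a = [ 1≤a ]
admissible-snoc (2≤x ∷ [])            1≤a = 2≤x ∷ [ 1≤a ]
admissible-snoc (2≤x ∷ 2≤L@(_ ∷ _))   1≤a = 2≤x ∷ admissible-snoc 2≤L 1≤a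

admissible-all : ∀ {L} → All (2 ≤_) L → Admissible L
admissible-all []                  = []
admissible-all (s≤s 1≤x ∷ [])      = [ s≤s z≤n ]
admissible-all (2≤x ∷ 2≤L@(_ ∷ _)) = 2≤x ∷ admissible-all 2≤L

D-lowestTerm : ∀ {as} → Admissible (reverse as) → LowestTerm (length as) (D as)
D-lowestTerm {as} adm = subst (λ n → LowestTerm n (D as)) (length-reverse as) (Drev-lowestTerm adm)

lemma2p1 : (α₁ : ℕ) (αs : List ℕ) → 1 ≤ α₁ → All (2 ≤_) αs →
  (Σ Poly (λ d → (D (α₁ ∷ αs) ≈ₚ tpow (length (α₁ ∷ αs)) *ₚ d) × (coeff d 0 ≢ 0ℤ)))
  × IsGCDₚ (D (α₁ ∷ αs)) (D αs) (tpow (length αs))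
lemma2p1 α₁ αs 1≤α₁ 2≤αs =
  (cofactor X-low , get (factorisation X-low) , coeff₀≢0) ,
  ∣⇒∣ₚ (lowestTerm⇒tpow∣ 1 X-low) , ∣⇒∣ₚ (lowestTerm⇒tpow∣ 0 Y-low) , greatest
  where
  open LowestTerm

  2≤rev : All (2 ≤_) (reverse αs)
  2≤rev = All-reverse 2≤αs

  X-low : LowestTerm (length (α₁ ∷ αs)) (D (α₁ ∷ αs))
  X-low = D-lowestTerm {α₁ ∷ αs} (subst Admissible (sym (unfold-reverse α₁ αs)) (admissible-snoc 2≤rev 1≤α₁))

  Y-low : LowestTerm (length αs) (D αs)
  Y-low = D-lowestTerm {αs} (admissible-all 2≤rev)

  coeff₀≢0 : coeff (cofactor X-low) 0 ≢ 0ℤ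
  coeff₀≢0 eq with () ← trans (sym (coeff₀-cofactor X-low)) eq

  greatest : ∀ h → h ∣ₚ D (α₁ ∷ αs) → h ∣ₚ D αs → h ∣ₚ tpow (length αs)
  greatest h h∣X h∣Y = ∣⇒∣ₚ (∣tpow⇒∣lowestTerm Y-low h∣Y′ (∣Drev∷ʳ∧∣Drev⇒∣tpow α₁ (reverse αs) h∣X′ h∣Y′))
    where
    h∣X′ : h ∣ Drev (reverse αs ∷ʳ α₁)
    h∣X′ = subst (λ L → h ∣ Drev L) (unfold-reverse α₁ αs) (∣ₚ⇒∣ h∣X)
    h∣Y′ : h ∣ D αs
    h∣Y′ = ∣ₚ⇒∣ h∣Y
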